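{- $g(5,3)=2$.
   Context: Let $S_n$ be the set of permutations of $[n]=\{1,\ldots,n\}$ (written as sequences) and $S_{n,k}$ the set of all sequences of $k$ distinct elements of $[n]$. A sequence $\kappa\in S_{n,k}$ is a subsequence of $\pi\in S_n$ if the elements of $\kappa$ appear in $\pi$ in the same relative order as in $\kappa$. A perfect sequence covering array $\mathrm{PSCA}(n,k)$ with multiplicity $\lambda$ (a positive integer) is a multiset $X$ of elements of $S_n$ such that every $\kappa\in S_{n,k}$ is a subsequence of exactly $\lambda$ elements of $X$ (counted with multiplicity). $g(n,k)$ denotes the smallest positive integer $\lambda$ such that a $\mathrm{PSCA}(n,k)$ with multiplicity $\lambda$ exists. -}

module Defs where

open import Data.Nat using (ℕ; _≤_; _<_)
open import Data.Fin using (Fin)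
open import Data.Fin.Properties using (_≟_)
open import Data.List using (List; length; filter; allFin)
open import Data.List.Relation.Unary.All using (All)
open import Data.List.Relation.Unary.Unique.Propositional using (Unique)
open import Data.List.Relation.Binary.Permutation.Propositional using (_↭_)
import Data.List.Relation.Binary.Sublist.DecPropositional as SL
open import Data.Product using (Σ; _×_)
open import Relation.Nullary using (¬_)
open import Relation.Binary.PropositionalEquality using (_≡_)

-- The ground set [n] is represented by Fin n (elements 0,…,n-1).

-- S_n : permutations of [n] written as sequences:
-- lists that are a rearrangement of 0,1,…,n-1.
IsPerm : (n : ℕ) → List (Fin n) → Set
IsPerm n π = π ↭ allFin n

IsSeq : (n k : ℕ) → List (Fin n) → Set
IsSeq n k κ = (length κ ≡ k) × Unique κ

_⊑_ : {n : ℕ} → List (Fin n) → List (Fin n) → Set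
_⊑_ {n} κ π = SL._⊆_ (_≟_ {n}) κ π

-- number of elements of the multiset X (a list, counted with
-- multiplicity) having κ as a subsequence
countCover : {n : ℕ} → List (Fin n) → List (List (Fin n)) → ℕ
countCover {n} κ X = length (filter (SL._⊆?_ (_≟_ {n}) κ) X)

IsPSCA : (n k λ' : ℕ) → List (List (Fin n)) → Set
IsPSCA n k λ' X =
  All (IsPerm n) X ×
  ((κ : List (Fin n)) → IsSeq n k κ → countCover κ X ≡ λ')

HasPSCA : (n k λ' : ℕ) → Set
HasPSCA n k λ' = Σ (List (List (Fin n))) (IsPSCA n k λ')

IsG : (n k λ' : ℕ) → Set
IsG n k λ' =
  (1 ≤ λ') × HasPSCA n k λ' ×
  ((μ : ℕ) → 1 ≤ μ → μ < λ' → ¬ HasPSCA n k μ)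

module Submission where

-- Upper bound: an explicit multiset X₂ of twelve permutations of [5] covers every
-- 3-sequence exactly twice; both facts are certified by computation.
--
-- Lower bound (no PSCA(5,3) with multiplicity 1): fix an element x and let i be its
-- position (0,…,4) in a permutation π of [5].  Then x is the first entry of exactly
-- C(4-i,2) and the middle entry of exactly i(4-i) of the 3-subsequences of π.  By
-- double counting, a PSCA(5,3) with multiplicity λ satisfies, for every x,
--     Σ_π C(4-pos_π x, 2) = 12λ   and   Σ_π pos_π x (4-pos_π x) = 12λ,
-- since exactly 12 sequences of S_{5,3} start with x and 12 have x in the middle.
-- Take x to be the middle element of some member.  Writing nᵢ for the number of
-- members in which x has position i, with n₂ ≥ 1 and λ = 1 the second equation
-- 3n₁ + 4n₂ + 3n₃ = 12 forces n₂ = 3 and n₁ = 0, and the first one then reads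
-- 6n₀ + 3 = 12, which has no solution.

open import Defs
open import Data.Nat using (ℕ; zero; suc; _+_; _*_; _∸_; _≤_; _<_; s≤s; z≤n)
open import Data.Nat.Properties using (+-commutativeSemigroup; *-zeroʳ)
import Data.Nat.Properties as ℕ
open import Data.Nat.Combinatorics using (_C_)
open import Data.Nat.ListAction using (sum)
open import Data.Nat.Tactic.RingSolver using (solve-∀)
open import Algebra.Properties.CommutativeSemigroup +-commutativeSemigroup using (interchange)
open import Data.Bool using (true; false; if_then_else_)
open import Data.Fin using (Fin; zero; suc; toℕ; fromℕ<; #_)
open import Data.Fin.Properties using (_≟_; all?; toℕ-fromℕ<)
open import Data.List using (List; []; _∷_; _++_; length; map; filter; allFin; lookup; cartesianProductWith)
open import Data.List.Properties using (map-cong; map-cong-local; map-∘; length-tabulate)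
open import Function using (id; _∘_)
open import Data.List.Membership.Propositional using (_∈_)
open import Data.List.Membership.Propositional.Properties using (∈-allFin; ∈-lookup; ∈-∃++)
import Data.List.Membership.DecPropositional as DecMembership
open import Data.List.Relation.Unary.All using (All; []; _∷_)
import Data.List.Relation.Unary.All as All
open import Data.List.Relation.Unary.AllPairs using (_∷_)
open import Data.List.Relation.Unary.Unique.Propositional using (Unique)
open import Data.List.Relation.Unary.Unique.Propositional.Properties using (allFin⁺)
import Data.List.Relation.Unary.Unique.DecPropositional as DecUnique
open import Data.List.Relation.Binary.Permutation.Propositional using (_↭_; refl; prep; ↭-sym; ↭-trans; ↭⇒↭ₛ)
open import Data.List.Relation.Binary.Permutation.Propositional.Properties using (shift; ↭-length; ∈-resp-↭)
open import Data.List.Relation.Binary.Permutation.Setoid.Properties using (Unique-resp-↭)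
import Data.List.Relation.Binary.Sublist.DecPropositional as Sublist
open import Data.Maybe using (Maybe; just; nothing; from-just)
import Data.Maybe as Maybe
open import Data.Product using (Σ; _,_; _×_; proj₁; proj₂)
open import Data.Empty using (⊥)
open import Relation.Nullary using (Dec; yes; no; does; ¬_; contradiction; _×-dec_; _→-dec_)
open import Relation.Nullary.Decidable using (toWitness)
open import Relation.Binary.PropositionalEquality
  using (_≡_; _≢_; refl; sym; trans; cong; cong₂; subst; setoid; module ≡-Reasoning)

private
  variable
    A B : Set
    n : ℕ

-- Counting and double counting

count : {P : A → Set} → ((x : A) → Dec (P x)) → List A → ℕ
count P? xs = length (filter P? xs)

indicator : {P : Set} → Dec P → ℕ
indicator d = if does d then 1 else 0

count-as-sum : {P : A → Set} (P? : (x : A) → Dec (P x)) (xs : List A) →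
               count P? xs ≡ sum (map (λ x → indicator (P? x)) xs)
count-as-sum P? [] = refl
count-as-sum P? (x ∷ xs) with does (P? x)
... | true  = cong suc (count-as-sum P? xs)
... | false = count-as-sum P? xs

sum-map-+ : (f g : A → ℕ) (xs : List A) →
            sum (map (λ x → f x + g x) xs) ≡ sum (map f xs) + sum (map g xs)
sum-map-+ f g [] = refl
sum-map-+ f g (x ∷ xs) =
  trans (cong (f x + g x +_) (sum-map-+ f g xs)) (interchange (f x) (g x) _ _)

sum-map-zero : (xs : List A) → sum (map (λ _ → 0) xs) ≡ 0
sum-map-zero []       = refl
sum-map-zero (_ ∷ xs) = sum-map-zero xs

sum-swap : (f : A → B → ℕ) (as : List A) (bs : List B) →
           sum (map (λ a → sum (map (f a) bs)) as) ≡ sum (map (λ b → sum (map (λ a → f a b) as)) bs)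
sum-swap f as []       = sum-map-zero as
sum-swap f as (b ∷ bs) =
  trans (sum-map-+ (λ a → f a b) (λ a → sum (map (f a) bs)) as)
        (cong (sum (map (λ a → f a b) as) +_) (sum-swap f as bs))

double-counting : {R : A → B → Set} (R? : ∀ a b → Dec (R a b)) (as : List A) (bs : List B) →
                  sum (map (λ a → count (R? a) bs) as) ≡ sum (map (λ b → count (λ a → R? a b) as) bs)
double-counting R? as bs = begin
  sum (map (λ a → count (R? a) bs) as)
    ≡⟨ cong sum (map-cong (λ a → count-as-sum (R? a) bs) as) ⟩
  sum (map (λ a → sum (map (λ b → indicator (R? a b)) bs)) as)
    ≡⟨ sum-swap (λ a b → indicator (R? a b)) as bs ⟩
  sum (map (λ b → sum (map (λ a → indicator (R? a b)) as)) bs)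
    ≡⟨ cong sum (map-cong (λ b → sym (count-as-sum (λ a → R? a b) as)) bs) ⟩
  sum (map (λ b → count (λ a → R? a b) as) bs) ∎
  where open ≡-Reasoning

coveredIn : List (List (Fin n)) → List (Fin n) → ℕ
coveredIn Ks π = count (λ κ → Sublist._⊆?_ _≟_ κ π) Ks

psca-coverage : {k λ' : ℕ} {X : List (List (Fin n))} → IsPSCA n k λ' X →
                (Ks : List (List (Fin n))) → All (IsSeq n k) Ks → sum (map (coveredIn Ks) X) ≡ length Ks * λ'
psca-coverage {X = X} (_ , covers) Ks seqs =
  trans (sym (double-counting (Sublist._⊆?_ _≟_) Ks X)) (each-λ-times Ks seqs)
  where
    each-λ-times : ∀ Ks → All (IsSeq _ _) Ks → sum (map (λ κ → countCover κ X) Ks) ≡ length Ks * _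
    each-λ-times []       []       = refl
    each-λ-times (κ ∷ Ks) (s ∷ ss) = cong₂ _+_ (covers κ s) (each-λ-times Ks ss)

position : Fin n → List (Fin n) → ℕ
position x []       = 0
position x (y ∷ ys) = if does (x ≟ y) then 0 else suc (position x ys)

position-lookup : {π : List (Fin n)} → Unique π → (i : Fin (length π)) → position (lookup π i) π ≡ toℕ i
position-lookup {π = y ∷ ys} _ zero with y ≟ y
... | yes _  = refl
... | no y≢y = contradiction refl y≢y
position-lookup {π = y ∷ ys} (y∉ys ∷ unique) (suc i) with lookup ys i ≟ y
... | yes z≡y = contradiction (sym z≡y) (All.lookup y∉ys (∈-lookup i))
... | no _    = cong suc (position-lookup unique i)

permutation-unique : {π : List (Fin n)} → IsPerm n π → Unique π
permutation-unique {n} σ = Unique-resp-↭ (setoid (Fin n)) (↭⇒↭ₛ (↭-sym σ)) (allFin⁺ n)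

middle-element : {π : List (Fin n)} → 3 ≤ n → IsPerm n π → Σ (Fin n) λ x → position x π ≡ 2
middle-element {π = π} 3≤n σ =
  lookup π third , trans (position-lookup (permutation-unique σ) third) (toℕ-fromℕ< _)
  where
    third : Fin (length π)
    third = fromℕ< (subst (3 ≤_) (sym (trans (↭-length σ) (length-tabulate id))) 3≤n)

-- The coverage profile of a position in a permutation of [5]

sequencesOfShape : (Fin n → Fin n → List (Fin n)) → List (List (Fin n))
sequencesOfShape {n} shape =
  filter (DecUnique.unique? _≟_) (cartesianProductWith shape (allFin n) (allFin n))

startingWith centredOn : Fin n → List (List (Fin n))
startingWith x = sequencesOfShape (λ u v → x ∷ u ∷ v ∷ [])
centredOn x = sequencesOfShape (λ u v → u ∷ x ∷ v ∷ [])

TwelveSequences : List (List (Fin 5)) → Set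
TwelveSequences Ks = All (IsSeq 5 3) Ks × length Ks ≡ 12

twelve-sequences? : (Ks : List (List (Fin 5))) → Dec (TwelveSequences Ks)
twelve-sequences? Ks = All.all? isSeq? Ks ×-dec length Ks ℕ.≟ 12
  where
    isSeq? : (κ : List (Fin 5)) → Dec (IsSeq 5 3 κ)
    isSeq? κ = (length κ ℕ.≟ 3) ×-dec DecUnique.unique? _≟_ κ

-- For n = 5 each family consists of 4 · 3 = 12 sequences (checked by evaluation).
startingWith-twelve : (x : Fin 5) → TwelveSequences (startingWith x)
startingWith-twelve = toWitness {a? = all? λ x → twelve-sequences? (startingWith x)} _

centredOn-twelve : (x : Fin 5) → TwelveSequences (centredOn x)
centredOn-twelve = toWitness {a? = all? λ x → twelve-sequences? (centredOn x)} _

-- An element at position i of a permutation of [5] precedes 4 - i others and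
-- follows i others, so it leads C(4-i,2) and is the centre of i(4-i) of its
-- 3-subsequences.
leadCount centreCount : ℕ → ℕ
leadCount i   = (4 ∸ i) C 2
centreCount i = i * (4 ∸ i)

Profile : Fin 5 → List (Fin 5) → Set
Profile x π = coveredIn (startingWith x) π ≡ leadCount (position x π)
            × coveredIn (centredOn x) π ≡ centreCount (position x π)

Covering : List (Fin 5) → Set
Covering π = All (_∈ π) (allFin 5)

five-tuple-profile : ∀ a b c d e → Covering (a ∷ b ∷ c ∷ d ∷ e ∷ []) → ∀ x → Profile x (a ∷ b ∷ c ∷ d ∷ e ∷ [])
five-tuple-profile = toWitness {a? = all? λ a → all? λ b → all? λ c → all? λ d → all? λ e →
    All.all? (_∈? (a ∷ b ∷ c ∷ d ∷ e ∷ [])) (allFin 5) →-dec all? λ x → profile? x (a ∷ b ∷ c ∷ d ∷ e ∷ [])} _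
  where
    open DecMembership (_≟_ {5}) using (_∈?_)
    profile? : ∀ x π → Dec (Profile x π)
    profile? x π = (coveredIn (startingWith x) π ℕ.≟ leadCount (position x π))
             ×-dec (coveredIn (centredOn x) π ℕ.≟ centreCount (position x π))

by-five-tuples : {P : List A → Set} → (∀ a b c d e → P (a ∷ b ∷ c ∷ d ∷ e ∷ [])) →
                 ∀ π → length π ≡ 5 → P π
by-five-tuples p (a ∷ b ∷ c ∷ d ∷ e ∷ []) _ = p a b c d e
by-five-tuples p []                          ()
by-five-tuples p (_ ∷ [])                    ()
by-five-tuples p (_ ∷ _ ∷ [])                ()
by-five-tuples p (_ ∷ _ ∷ _ ∷ [])            ()
by-five-tuples p (_ ∷ _ ∷ _ ∷ _ ∷ [])        ()
by-five-tuples p (_ ∷ _ ∷ _ ∷ _ ∷ _ ∷ _ ∷ _) ()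

permutation-profile : {π : List (Fin 5)} → IsPerm 5 π → ∀ x → Profile x π
permutation-profile {π} σ =
  by-five-tuples {P = λ π → Covering π → ∀ x → Profile x π} five-tuple-profile π
    (↭-length σ) (All.tabulate λ {y} _ → ∈-resp-↭ (↭-sym σ) (∈-allFin y))

-- The two counting equations

position-equations : {λ' : ℕ} {X : List (List (Fin 5))} → IsPSCA 5 3 λ' X → (x : Fin 5) →
                     sum (map leadCount (map (position x) X)) ≡ 12 * λ'
                   × sum (map centreCount (map (position x) X)) ≡ 12 * λ'
position-equations {λ'} {X} psca@(perms , _) x =
  via (proj₁ ∘ profiles) (startingWith-twelve x) , via (proj₂ ∘ profiles) (centredOn-twelve x)
  where
    profiles : ∀ {π} → IsPerm 5 π → Profile x π
    profiles σ = permutation-profile σ x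

    via : {Ks : List (List (Fin 5))} {weight : ℕ → ℕ} →
          (∀ {π} → IsPerm 5 π → coveredIn Ks π ≡ weight (position x π)) →
          TwelveSequences Ks → sum (map weight (map (position x) X)) ≡ 12 * λ'
    via {Ks} {weight} profile (seqs , twelve) = begin
      sum (map weight (map (position x) X))  ≡⟨ cong sum (map-∘ X) ⟨
      sum (map (weight ∘ position x) X)      ≡⟨ cong sum (map-cong-local (All.map profile perms)) ⟨
      sum (map (coveredIn Ks) X)             ≡⟨ psca-coverage psca Ks seqs ⟩
      length Ks * λ'                         ≡⟨ cong (_* λ') twelve ⟩
      12 * λ'                                ∎
      where open ≡-Reasoning

-- Arithmetic of the counting equations

occurrences : ℕ → List ℕ → ℕ
occurrences i = count (ℕ._≟ i)

into-slot₀ : ∀ w a b c d → w + (a + b + c + d) ≡ (w + a) + b + c + d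
into-slot₀ = solve-∀
into-slot₁ : ∀ w a b c d → w + (a + b + c + d) ≡ a + (w + b) + c + d
into-slot₁ = solve-∀
into-slot₂ : ∀ w a b c d → w + (a + b + c + d) ≡ a + b + (w + c) + d
into-slot₂ = solve-∀
into-slot₃ : ∀ w a b c d → w + (a + b + c + d) ≡ a + b + c + (w + d)
into-slot₃ = solve-∀

sum-by-tally : (φ : ℕ → ℕ) → (∀ i → φ (4 + i) ≡ 0) → (ps : List ℕ) →
               sum (map φ ps) ≡ occurrences 0 ps * φ 0 + occurrences 1 ps * φ 1
                              + occurrences 2 ps * φ 2 + occurrences 3 ps * φ 3
sum-by-tally φ vanishes []       = refl
sum-by-tally φ vanishes (p ∷ ps) = trans (cong (φ p +_) (sum-by-tally φ vanishes ps)) (insert p)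
  where
    tally : ℕ → ℕ
    tally i = occurrences i ps * φ i

    insert : ∀ p → φ p + (tally 0 + tally 1 + tally 2 + tally 3)
                 ≡ occurrences 0 (p ∷ ps) * φ 0 + occurrences 1 (p ∷ ps) * φ 1
                   + occurrences 2 (p ∷ ps) * φ 2 + occurrences 3 (p ∷ ps) * φ 3
    insert 0 = into-slot₀ (φ 0) (tally 0) (tally 1) (tally 2) (tally 3)
    insert 1 = into-slot₁ (φ 1) (tally 0) (tally 1) (tally 2) (tally 3)
    insert 2 = into-slot₂ (φ 2) (tally 0) (tally 1) (tally 2) (tally 3)
    insert 3 = into-slot₃ (φ 3) (tally 0) (tally 1) (tally 2) (tally 3)
    insert (suc (suc (suc (suc i)))) = cong (_+ (tally 0 + tally 1 + tally 2 + tally 3)) (vanishes i)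

-- The first counting sum as 6n₀ + 3n₁ + n₂ (ordered for the case analysis below).
lead-tally : (ps : List ℕ) →
             sum (map leadCount ps) ≡ occurrences 2 ps + occurrences 1 ps * 3 + occurrences 0 ps * 6
lead-tally ps = trans (sum-by-tally leadCount vanishes ps)
  (tidy (occurrences 0 ps) (occurrences 1 ps) (occurrences 2 ps) (occurrences 3 ps))
  where
    vanishes : ∀ i → leadCount (4 + i) ≡ 0
    vanishes zero    = refl
    vanishes (suc _) = refl
    tidy : ∀ a b c d → a * 6 + b * 3 + c * 1 + d * 0 ≡ c + b * 3 + a * 6
    tidy = solve-∀

centre-tally : (ps : List ℕ) →
               sum (map centreCount ps) ≡ occurrences 2 ps * 4 + (occurrences 1 ps + occurrences 3 ps) * 3
centre-tally ps = trans (sum-by-tally centreCount vanishes ps)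
  (tidy (occurrences 0 ps) (occurrences 1 ps) (occurrences 2 ps) (occurrences 3 ps))
  where
    vanishes : ∀ i → centreCount (4 + i) ≡ 0
    vanishes zero    = refl
    vanishes (suc i) = *-zeroʳ (5 + i)
    tidy : ∀ a b c d → a * 0 + b * 3 + c * 4 + d * 3 ≡ c * 4 + (b + d) * 3
    tidy = solve-∀

-- 4(c+1) + 3m = 12 forces c + 1 = 3 (divisibility by 3) and then m = 0.
centre-equation : ∀ c m → suc c * 4 + m * 3 ≡ 12 → c ≡ 2 × m ≡ 0
centre-equation 0 0                   ()
centre-equation 0 1                   ()
centre-equation 0 2                   ()
centre-equation 0 (suc (suc (suc _))) ()
centre-equation 1 0                   ()
centre-equation 1 1                   ()
centre-equation 1 (suc (suc _))       ()
centre-equation 2 0                   _  = refl , refl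
centre-equation 2 (suc _)             ()
centre-equation (suc (suc (suc _))) _ ()

-- 6a + 3 is odd, so it is not 12.
lead-equation : ∀ a → 3 + a * 6 ≢ 12
lead-equation 0             ()
lead-equation 1             ()
lead-equation (suc (suc _)) ()

-- The tally equations have no solution with n₂ ≥ 1 (here n₂ = suc c).
tally-unsolvable : ∀ a b c d → suc c + b * 3 + a * 6 ≡ 12 → suc c * 4 + (b + d) * 3 ≡ 12 → ⊥
tally-unsolvable a b c d lead centre with centre-equation c (b + d) centre
... | refl , b+d≡0 with ℕ.m+n≡0⇒m≡0 b b+d≡0
... | refl = lead-equation a lead

middle-position-impossible : (ps : List ℕ) →
  sum (map leadCount (2 ∷ ps)) ≡ 12 → sum (map centreCount (2 ∷ ps)) ≡ 12 → ⊥
middle-position-impossible ps lead centre =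
  tally-unsolvable (occurrences 0 ps) (occurrences 1 ps) (occurrences 2 ps) (occurrences 3 ps)
    (trans (sym (lead-tally (2 ∷ ps))) lead) (trans (sym (centre-tally (2 ∷ ps))) centre)

no-PSCA-multiplicity-1 : ¬ HasPSCA 5 3 1
no-PSCA-multiplicity-1 ([] , _ , covers)
  with covers (# 0 ∷ # 1 ∷ # 2 ∷ []) (refl , toWitness {a? = DecUnique.unique? _≟_ (# 0 ∷ # 1 ∷ # 2 ∷ [])} _)
... | ()
no-PSCA-multiplicity-1 (π ∷ X , psca@(σ ∷ _ , _)) =
  from-middle-element (middle-element (s≤s (s≤s (s≤s z≤n))) σ)
  where
    from-middle-element : Σ (Fin 5) (λ x → position x π ≡ 2) → ⊥
    from-middle-element (x , at-2) =
      middle-position-impossible (map (position x) X)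
        (at-middle (proj₁ (position-equations psca x))) (at-middle (proj₂ (position-equations psca x)))
      where
        at-middle : {weight : ℕ → ℕ} → sum (map weight (position x π ∷ map (position x) X)) ≡ 12 * 1 →
                    sum (map weight (2 ∷ map (position x) X)) ≡ 12
        at-middle {weight} = subst (λ i → sum (map weight (i ∷ map (position x) X)) ≡ 12) at-2

-- A PSCA(5,3) with multiplicity 2

permutation? : (xs ys : List (Fin n)) → Maybe (xs ↭ ys)
permutation? []       []      = just refl
permutation? []       (_ ∷ _) = nothing
permutation? (x ∷ xs) ys with x ∈? ys
  where open DecMembership _≟_ using (_∈?_)
... | no _    = nothing
... | yes x∈ys with ∈-∃++ x∈ys
...   | as , bs , refl = Maybe.map (λ σ → ↭-trans (prep x σ) (↭-sym (shift x as bs))) (permutation? xs (as ++ bs))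

certify-all : {P : A → Set} → ((x : A) → Maybe (P x)) → (xs : List A) → Maybe (All P xs)
certify-all certify []       = just []
certify-all certify (x ∷ xs) = Maybe.zipWith _∷_ (certify x) (certify-all certify xs)

by-triples : {P : List (Fin n) → Set} → (∀ a b c → Unique (a ∷ b ∷ c ∷ []) → P (a ∷ b ∷ c ∷ [])) →
             (κ : List (Fin n)) → IsSeq n 3 κ → P κ
by-triples p (a ∷ b ∷ c ∷ [])    (_ , distinct) = p a b c distinct
by-triples p []                  (() , _)
by-triples p (_ ∷ [])            (() , _)
by-triples p (_ ∷ _ ∷ [])        (() , _)
by-triples p (_ ∷ _ ∷ _ ∷ _ ∷ _) (() , _)

X₂ : List (List (Fin 5))
X₂ = (# 3 ∷ # 4 ∷ # 0 ∷ # 1 ∷ # 2 ∷ []) ∷ (# 0 ∷ # 1 ∷ # 3 ∷ # 2 ∷ # 4 ∷ [])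
   ∷ (# 2 ∷ # 0 ∷ # 1 ∷ # 3 ∷ # 4 ∷ []) ∷ (# 1 ∷ # 0 ∷ # 2 ∷ # 4 ∷ # 3 ∷ [])
   ∷ (# 4 ∷ # 0 ∷ # 2 ∷ # 3 ∷ # 1 ∷ []) ∷ (# 0 ∷ # 4 ∷ # 3 ∷ # 2 ∷ # 1 ∷ [])
   ∷ (# 3 ∷ # 1 ∷ # 0 ∷ # 4 ∷ # 2 ∷ []) ∷ (# 3 ∷ # 2 ∷ # 0 ∷ # 4 ∷ # 1 ∷ [])
   ∷ (# 2 ∷ # 3 ∷ # 1 ∷ # 4 ∷ # 0 ∷ []) ∷ (# 1 ∷ # 4 ∷ # 3 ∷ # 2 ∷ # 0 ∷ [])
   ∷ (# 2 ∷ # 4 ∷ # 1 ∷ # 0 ∷ # 3 ∷ []) ∷ (# 4 ∷ # 1 ∷ # 2 ∷ # 3 ∷ # 0 ∷ []) ∷ []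

X₂-permutations : All (IsPerm 5) X₂
X₂-permutations = from-just (certify-all (λ π → permutation? π (allFin 5)) X₂)

X₂-covers : (κ : List (Fin 5)) → IsSeq 5 3 κ → countCover κ X₂ ≡ 2
X₂-covers = by-triples (toWitness {a? = all? λ a → all? λ b → all? λ c →
  DecUnique.unique? _≟_ (a ∷ b ∷ c ∷ []) →-dec countCover (a ∷ b ∷ c ∷ []) X₂ ℕ.≟ 2} _)

proposition1 : IsG 5 3 2
proposition1 = s≤s z≤n , (X₂ , X₂-permutations , X₂-covers) , below-2
  where
    below-2 : (μ : ℕ) → 1 ≤ μ → μ < 2 → ¬ HasPSCA 5 3 μ
    below-2 1             _ _                 = no-PSCA-multiplicity-1
    below-2 (suc (suc _)) _ (s≤s (s≤s ()))
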